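{- Let $n\geq 1$ and let $K_{2,n}$ be the complete bipartite graph with parts $\{v_0,v_1\}$ and $\{v_2,\ldots,v_{n+1}\}$, with sink $v_0$. Its lacking polynomial is $$L_{2,n}(x)=\sum_{k=0}^{n-1}\sum_{i=0}^{k}\binom{n}{i}x^k.$$
   Context: Let $G$ be a finite connected loop-free graph with a distinguished sink vertex $s$. A configuration assigns a non-negative integer $c(v)$ to each non-sink vertex $v$; it is stable if $c(v)<d(v)$ for every non-sink $v$, where $d(v)$ is the degree. For an orientation $\mathcal{O}$ of $G$, $\mathrm{in}_{\mathcal{O}}(v)$ is the number of edges directed into $v$; $c$ is compatible with $\mathcal{O}$ if $\mathrm{in}_{\mathcal{O}}(v)\geq d(v)-c(v)$ for every non-sink $v$. The set $\mathsf{Sto}(G)$ of stochastically recurrent states is the set of stable configurations compatible with at least one orientation of $G$. The lacking polynomial is $L_G(x)=\sum_{c\in\mathsf{Sto}(G)}x^{\ell(c)}$, where $\ell(c)=\sum_{v\neq s}(d(v)-c(v)-1)$. $L_{2,n}$ denotes $L_{K_{2,n}}$ with sink $v_0$. -}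

module Defs where

open import Data.Nat using (ℕ; zero; suc; _+_; _∸_; _≤_; _≤?_; _<_)
open import Data.Nat.Properties using (_≟_)
open import Data.Bool using (Bool; true; false; if_then_else_)
open import Data.Fin using (Fin; zero; suc)
import Data.Fin.Properties as FinP
open import Data.List using (List; []; _∷_; length; map; filter; concatMap; upTo; allFin; zip)
open import Data.Nat.ListAction using (sum)
open import Data.List.Relation.Unary.Any using (any?)
open import Data.Vec using (Vec; []; _∷_; lookup; tabulate; toList)
open import Data.Product using (_×_; _,_; proj₁; proj₂; ∃)
open import Data.Sum using (_⊎_)
open import Relation.Binary.PropositionalEquality using (_≡_)
open import Relation.Nullary using (Dec)
open import Relation.Nullary.Decidable using (_⊎-dec_)

-- A finite (multi)graph with a distinguished sink.
-- Vertices are Fin (suc V'); the sink is `zero`, the non-sink vertices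
-- are `suc i` for i : Fin V'.  Edges are listed as (unordered) pairs.
record Graph : Set where
  field
    V' : ℕ
    E  : List (Fin (suc V') × Fin (suc V'))
open Graph public

Vtx : Graph → Set
Vtx G = Fin (suc (V' G))

-- degree: number of edges incident to v (graphs here are loop-free)
deg : (G : Graph) → Vtx G → ℕ
deg G v = length (filter (λ e → (proj₁ e FinP.≟ v) ⊎-dec (proj₂ e FinP.≟ v)) (E G))

-- An orientation chooses a direction for each edge:
-- for edge (u , w), `true` means u → w and `false` means w → u.
Orientation : Graph → Set
Orientation G = Vec Bool (length (E G))

headOf : ∀ {A : Set} → (A × A) × Bool → A
headOf ((u , w) , b) = if b then w else u

indeg : (G : Graph) → Orientation G → Vtx G → ℕ
indeg G O v = length (filter (λ p → headOf p FinP.≟ v) (zip (E G) (toList O)))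

-- configurations on the non-sink vertices: c(suc i) = lookup c i
Config : Graph → Set
Config G = Vec ℕ (V' G)

Stable : (G : Graph) → Config G → Set
Stable G c = ∀ (i : Fin (V' G)) → lookup c i < deg G (suc i)

Compatible : (G : Graph) → Config G → Orientation G → Set
Compatible G c O = ∀ (i : Fin (V' G)) → deg G (suc i) ∸ lookup c i ≤ indeg G O (suc i)

compatible? : (G : Graph) → (c : Config G) → (O : Orientation G) → Dec (Compatible G c O)
compatible? G c O = FinP.all? (λ i → deg G (suc i) ∸ lookup c i ≤? indeg G O (suc i))

Sto : (G : Graph) → Config G → Set
Sto G c = Stable G c × ∃ (Compatible G c)

allBoolVecs : (m : ℕ) → List (Vec Bool m)
allBoolVecs zero = [] ∷ []
allBoolVecs (suc m) = concatMap (λ b → map (b ∷_) (allBoolVecs m)) (true ∷ false ∷ [])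

boundedVecs : {m : ℕ} → Vec ℕ m → List (Vec ℕ m)
boundedVecs [] = [] ∷ []
boundedVecs (b ∷ bs) = concatMap (λ x → map (x ∷_) (boundedVecs bs)) (upTo b)

stableConfigs : (G : Graph) → List (Config G)
stableConfigs G = boundedVecs (tabulate (λ i → deg G (suc i)))

stoList : (G : Graph) → List (Config G)
stoList G = filter (λ c → any? (compatible? G c) (allBoolVecs (length (E G)))) (stableConfigs G)

lackLevel : (G : Graph) → Config G → ℕ
lackLevel G c = sum (map (λ i → deg G (suc i) ∸ lookup c i ∸ 1) (allFin (V' G)))

-- coefficient of x^k in the lacking polynomial L_G(x)
lackCoeff : Graph → ℕ → ℕ
lackCoeff G k = length (filter (λ c → lackLevel G c ≟ k) (stoList G))

-- K_{2,n}: vertices v_0 (= zero, the sink), v_1, v_2, ..., v_{n+1};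
-- edges v_a v_{j+2} for a ∈ {0,1}, j < n.
K2 : (n : ℕ) → Graph
K2 n = record
  { V' = suc n
  ; E  = map (λ j → (zero , suc (suc j))) (allFin n)
         Data.List.++ map (λ j → (suc zero , suc (suc j))) (allFin n)
  }

{-# OPTIONS --safe #-}

-- Write a configuration of K₂,ₙ as (c₁, cs), with c₁ chips on v₁ and cs ∈ {0,1}ⁿ on the leaves, and let
-- t = n ∸ c₁ be the deficit at v₁.  Compatibility asks for in-degree ≥ t at v₁ and ≥ 2 ∸ cⱼ at leaf j,
-- while the in-degrees sum to 2n because every edge has exactly one head; so some orientation is
-- compatible iff t ≤ o, the number of chips on the leaves (for the converse, direct v₁ — leaf j towards
-- v₁ exactly at the leaves holding a chip).  The level is (t − 1) + z with z = n − o the number of empty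
-- leaves, so for fixed cs exactly one c₁ contributes to x^k when z ≤ k < n, and none otherwise.  Hence
-- the coefficient of x^k counts the 0/1-vectors of length n with at most k zeros, which is
-- ∑_{i ≤ k} C(n, i) by Pascal's rule.
module Submission where

open import Data.Bool using (Bool; true; false; if_then_else_)
open import Data.Fin using (Fin; zero; suc)
import Data.Fin.Properties as FinP
open import Data.List using (List; []; _∷_; _++_; map; filter; length; concatMap; upTo; tabulate; allFin; zip)
open import Data.List.Properties
  using (map-++; map-∘; map-cong; map-cong-local; map-upTo; upTo-∷ʳ; length-++; length-map; length-tabulate; length-zipWith)
open import Data.List.Relation.Unary.All as All using (All; []; _∷_)
open import Data.List.Relation.Unary.All.Properties using (all-upTo; concat⁺; applyUpTo⁺₁) renaming (map⁺ to All-map⁺)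
open import Data.List.Relation.Unary.Any using (Any; here; satisfied; any?)
open import Data.List.Relation.Unary.Any.Properties using (map⁺; ++⁺ˡ; ++⁺ʳ)
open import Data.Nat using (ℕ; zero; suc; _≡ᵇ_; _+_; _*_; _∸_; _⊓_; _≤_; _<_; s≤s; z≤n; s≤s⁻¹)
open import Data.Nat.Combinatorics using (_C_; nCk+nC[k+1]≡[n+1]C[k+1])
open import Data.Nat.ListAction using (sum)
open import Data.Nat.ListAction.Properties using (sum-++)
open import Data.Nat.Properties as ℕ
  using (_≟_; _≤?_; +-comm; +-suc; +-identityʳ; *-comm; *-identityʳ; ⊓-idem; ≤-trans; <-irrefl; <⇒≤; ≤-<-trans;
         +-mono-≤; +-monoˡ-<; +-cancelʳ-≤; m≤m+n; m≤n+m; m∸n≤m; m+n∸n≡m; m∸n+n≡m; module ≤-Reasoning)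
open import Algebra.Properties.CommutativeMonoid.Sum ℕ.+-0-commutativeMonoid
  using (sum-syntax; ∑-distrib-+; sum-cong-≗; sum-replicate-zero)
open import Algebra.Properties.CommutativeSemigroup ℕ.+-commutativeSemigroup using (interchange)
open import Data.Product using (_×_; _,_; proj₁; proj₂; ∃)
open import Data.Product.Function.NonDependent.Propositional using (_×-⇔_)
open import Data.Vec as Vec using (Vec; toList; lookup) renaming ([] to []ᵥ; _∷_ to _∷ᵥ_)
open import Data.Vec.Properties
  using (toList-map; toList∘fromList; length-toList; tabulate-cong; tabulate∘lookup; lookup-replicate)
open import Function using (_∘_; id; _⇔_; mk⇔)
open import Function.Properties.Equivalence using () renaming (refl to ⇔-refl; trans to ⇔-trans)
open import Level using (Level)
open import Relation.Binary.PropositionalEquality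
open import Relation.Nullary using (Dec; yes; no; does; ¬_; _⊎-dec_; _×-dec_)
open import Relation.Nullary.Decidable using (does-⇔; dec-true; dec-false)
open import Relation.Unary using (Pred; Decidable; ∁)
open import Relation.Unary.Properties using (_∩?_)

open import Defs

private variable
  a p q : Level
  A B D : Set a

⟦_⟧ : {P : Set p} → Dec P → ℕ
⟦ P? ⟧ = if does P? then 1 else 0

⟦⟧-⇔ : {P : Set p} {Q : Set q} → P ⇔ Q → (P? : Dec P) (Q? : Dec Q) → ⟦ P? ⟧ ≡ ⟦ Q? ⟧
⟦⟧-⇔ P⇔Q P? Q? = cong (λ b → if b then 1 else 0) (does-⇔ P⇔Q P? Q?)

sum-map-++ : (f : A → ℕ) (xs ys : List A) → sum (map f (xs ++ ys)) ≡ sum (map f xs) + sum (map f ys)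
sum-map-++ f xs ys = trans (cong sum (map-++ f xs ys)) (sum-++ (map f xs) (map f ys))

sum-map-concatMap : (f : B → ℕ) (g : A → List B) (xs : List A) →
  sum (map f (concatMap g xs)) ≡ sum (map (λ x → sum (map f (g x))) xs)
sum-map-concatMap f g []       = refl
sum-map-concatMap f g (x ∷ xs) =
  trans (sum-map-++ f (g x) (concatMap g xs)) (cong (sum (map f (g x)) +_) (sum-map-concatMap f g xs))

sum-map-+ : (f g : A → ℕ) (xs : List A) → sum (map (λ x → f x + g x) xs) ≡ sum (map f xs) + sum (map g xs)
sum-map-+ f g []       = refl
sum-map-+ f g (x ∷ xs) =
  trans (cong (f x + g x +_) (sum-map-+ f g xs)) (interchange (f x) (g x) (sum (map f xs)) (sum (map g xs)))

sum-map-zero : (xs : List A) → sum (map (λ _ → 0) xs) ≡ 0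
sum-map-zero []       = refl
sum-map-zero (x ∷ xs) = sum-map-zero xs

sum-map-comm : (h : A → B → ℕ) (xs : List A) (ys : List B) →
  sum (map (λ x → sum (map (h x) ys)) xs) ≡ sum (map (λ y → sum (map (λ x → h x y) xs)) ys)
sum-map-comm h []       ys = sym (sum-map-zero ys)
sum-map-comm h (x ∷ xs) ys =
  trans (cong (sum (map (h x) ys) +_) (sum-map-comm h xs ys)) (sym (sum-map-+ (h x) _ ys))

sum-map-tabulate : ∀ {n} (f : A → ℕ) (g : Fin n → A) → sum (map f (tabulate g)) ≡ ∑[ i < n ] f (g i)
sum-map-tabulate {n = zero}  f g = refl
sum-map-tabulate {n = suc n} f g = cong (f (g zero) +_) (sum-map-tabulate f (g ∘ suc))

sum-map-upTo-suc : (f : ℕ → ℕ) (n : ℕ) → sum (map f (upTo (suc n))) ≡ f 0 + sum (map (f ∘ suc) (upTo n))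
sum-map-upTo-suc f n =
  cong (λ xs → f 0 + sum xs) (trans (cong (map f) (sym (map-upTo suc n))) (sym (map-∘ (upTo n))))

sum-map-upTo-∷ʳ : (f : ℕ → ℕ) (n : ℕ) → sum (map f (upTo (suc n))) ≡ sum (map f (upTo n)) + f n
sum-map-upTo-∷ʳ f n = begin
  sum (map f (upTo (suc n)))          ≡⟨ cong (sum ∘ map f) (upTo-∷ʳ n) ⟨
  sum (map f (upTo n ++ n ∷ []))      ≡⟨ sum-map-++ f (upTo n) (n ∷ []) ⟩
  sum (map f (upTo n)) + (f n + 0)    ≡⟨ cong (sum (map f (upTo n)) +_) (+-identityʳ (f n)) ⟩
  sum (map f (upTo n)) + f n          ∎
  where open ≡-Reasoning

sum-map-upTo-reflect : (f : ℕ → ℕ) (n : ℕ) →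
  sum (map (λ c → f (n ∸ c)) (upTo n)) ≡ sum (map (f ∘ suc) (upTo n))
sum-map-upTo-reflect f zero    = refl
sum-map-upTo-reflect f (suc n) = begin
  sum (map (λ c → f (suc n ∸ c)) (upTo (suc n)))    ≡⟨ sum-map-upTo-suc (λ c → f (suc n ∸ c)) n ⟩
  f (suc n) + sum (map (λ c → f (n ∸ c)) (upTo n))  ≡⟨ cong (f (suc n) +_) (sum-map-upTo-reflect f n) ⟩
  f (suc n) + sum (map (f ∘ suc) (upTo n))          ≡⟨ +-comm (f (suc n)) _ ⟩
  sum (map (f ∘ suc) (upTo n)) + f (suc n)          ≡⟨ sum-map-upTo-∷ʳ (f ∘ suc) n ⟨
  sum (map (f ∘ suc) (upTo (suc n)))                ∎
  where open ≡-Reasoning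

count : {P : Pred A p} → Decidable P → List A → ℕ
count P? xs = sum (map (λ x → ⟦ P? x ⟧) xs)

module _ {P : Pred A p} (P? : Decidable P) where

  length-filter≡count : (xs : List A) → length (filter P? xs) ≡ count P? xs
  length-filter≡count []       = refl
  length-filter≡count (x ∷ xs) with does (P? x)
  ... | true  = cong suc (length-filter≡count xs)
  ... | false = length-filter≡count xs

  count-filter : {Q : Pred A q} (Q? : Decidable Q) (xs : List A) →
    count P? (filter Q? xs) ≡ count (Q? ∩? P?) xs
  count-filter Q? []       = refl
  count-filter Q? (x ∷ xs) with does (Q? x)
  ... | true  = cong (⟦ P? x ⟧ +_) (count-filter Q? xs)
  ... | false = count-filter Q? xs

  count-cong-local : {Q : Pred A q} (Q? : Decidable Q) {xs : List A} →
    All (λ x → P x ⇔ Q x) xs → count P? xs ≡ count Q? xs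
  count-cong-local Q? P⇔Q = cong sum (map-cong-local (All.map (λ {x} e → ⟦⟧-⇔ e (P? x) (Q? x)) P⇔Q))

  count-none : {xs : List A} → All (∁ P) xs → count P? xs ≡ 0
  count-none []           = refl
  count-none (¬px ∷ ¬pxs) = cong₂ (λ b n → (if b then 1 else 0) + n) (dec-false (P? _) ¬px) (count-none ¬pxs)

count-cong : {P : Pred A p} {Q : Pred A q} (P? : Decidable P) (Q? : Decidable Q) →
  (∀ {x} → P x ⇔ Q x) → (xs : List A) → count P? xs ≡ count Q? xs
count-cong P? Q? P⇔Q xs = count-cong-local P? Q? (All.universal (λ _ → P⇔Q) xs)

count-map : {P : Pred B p} (P? : Decidable P) (f : A → B) (xs : List A) →
  count P? (map f xs) ≡ count (P? ∘ f) xs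
count-map P? f xs = cong sum (sym (map-∘ xs))

count-concatMap-map : {P : Pred D p} (P? : Decidable P) (f : A → B → D) (xs : List A) (ys : List B) →
  count P? (concatMap (λ x → map (f x) ys) xs) ≡ sum (map (λ y → count (λ x → P? (f x y)) xs) ys)
count-concatMap-map P? f xs ys = begin
  count P? (concatMap (λ x → map (f x) ys) xs)             ≡⟨ sum-map-concatMap _ (λ x → map (f x) ys) xs ⟩
  sum (map (λ x → count P? (map (f x) ys)) xs)              ≡⟨ cong sum (map-cong (λ x → count-map P? (f x) ys) xs) ⟩
  sum (map (λ x → sum (map (λ y → ⟦ P? (f x y) ⟧) ys)) xs)  ≡⟨ sum-map-comm (λ x y → ⟦ P? (f x y) ⟧) xs ys ⟩
  sum (map (λ y → count (λ x → P? (f x y)) xs) ys)          ∎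
  where open ≡-Reasoning

count-≟-upTo : ∀ {m n} → m < n → count (_≟ m) (upTo n) ≡ 1
count-≟-upTo {zero}  {suc n} _         =
  trans (sum-map-upTo-suc (λ t → ⟦ t ≟ 0 ⟧) n) (cong suc (sum-map-zero (upTo n)))
count-≟-upTo {suc m} {suc n} (s≤s m<n) =
  trans (sum-map-upTo-suc (λ t → ⟦ t ≟ suc m ⟧) n) (count-≟-upTo m<n)

count-upTo-unique : ∀ {P : Pred ℕ p} (P? : Decidable P) {m n} → m < n → (∀ {t} → t < n → P t ⇔ t ≡ m) →
  count P? (upTo n) ≡ 1
count-upTo-unique P? {m} {n} m<n P⇔≡m =
  trans (count-cong-local P? (_≟ m) (All.map P⇔≡m (all-upTo n))) (count-≟-upTo m<n)

∑-const : ∀ n c → ∑[ i < n ] c ≡ n * c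
∑-const zero    c = refl
∑-const (suc n) c = cong (c +_) (∑-const n c)

∑-mono-≤ : ∀ {n} {f g : Fin n → ℕ} → (∀ i → f i ≤ g i) → ∑[ i < n ] f i ≤ ∑[ i < n ] g i
∑-mono-≤ {zero}  f≤g = z≤n
∑-mono-≤ {suc n} f≤g = +-mono-≤ (f≤g zero) (∑-mono-≤ (f≤g ∘ suc))

≤-∑ : ∀ {n} (f : Fin n → ℕ) (i : Fin n) → f i ≤ ∑[ j < n ] f j
≤-∑ f zero    = m≤m+n (f zero) _
≤-∑ f (suc i) = ≤-trans (≤-∑ (f ∘ suc) i) (m≤n+m _ (f zero))

∑-⟦≟⟧ˡ : ∀ {m} (w : Fin m) → ∑[ v < m ] ⟦ v FinP.≟ w ⟧ ≡ 1
∑-⟦≟⟧ˡ {suc m} zero    = cong suc (sum-replicate-zero m)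
∑-⟦≟⟧ˡ         (suc w) = ∑-⟦≟⟧ˡ w

∑-⟦≟⟧ʳ : ∀ {m} (w : Fin m) → ∑[ v < m ] ⟦ w FinP.≟ v ⟧ ≡ 1
∑-⟦≟⟧ʳ {suc m} zero    = cong suc (sum-replicate-zero m)
∑-⟦≟⟧ʳ         (suc w) = ∑-⟦≟⟧ʳ w

∑-count-≟ : ∀ {m} (h : A → Fin m) (xs : List A) → ∑[ v < m ] count (λ x → h x FinP.≟ v) xs ≡ length xs
∑-count-≟ {m = m} h []       = sum-replicate-zero m
∑-count-≟         h (x ∷ xs) =
  trans (∑-distrib-+ (λ v → ⟦ h x FinP.≟ v ⟧) (λ v → count (λ y → h y FinP.≟ v) xs))
        (cong₂ _+_ (∑-⟦≟⟧ʳ (h x)) (∑-count-≟ h xs))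

count-map-allFin : ∀ {n} {P : Pred A p} (P? : Decidable P) (f : Fin n → A) →
  count P? (map f (allFin n)) ≡ ∑[ j < n ] ⟦ P? (f j) ⟧
count-map-allFin {n = n} P? f =
  trans (count-map P? f (allFin n)) (sum-map-tabulate (λ j → ⟦ P? (f j) ⟧) id)

∑-indeg : (G : Graph) (O : Orientation G) → ∑[ v < suc (V' G) ] indeg G O v ≡ length (E G)
∑-indeg G O = begin
  ∑[ v < suc (V' G) ] indeg G O v
    ≡⟨ sum-cong-≗ (λ v → length-filter≡count (λ p → headOf p FinP.≟ v) arcs) ⟩
  ∑[ v < suc (V' G) ] count (λ p → headOf p FinP.≟ v) arcs
    ≡⟨ ∑-count-≟ headOf arcs ⟩
  length arcs                        ≡⟨ length-zipWith _,_ (E G) (toList O) ⟩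
  length (E G) ⊓ length (toList O)   ≡⟨ cong (length (E G) ⊓_) (length-toList O) ⟩
  length (E G) ⊓ length (E G)        ≡⟨ ⊓-idem (length (E G)) ⟩
  length (E G)                       ∎
  where
  open ≡-Reasoning
  arcs = zip (E G) (toList O)

orientBy : (G : Graph) → (Vtx G × Vtx G → Bool) → Orientation G
orientBy G dir = Vec.map dir (Vec.fromList (E G))

zip-map : (f : A → B) (xs : List A) → zip xs (map f xs) ≡ map (λ x → x , f x) xs
zip-map f []       = refl
zip-map f (x ∷ xs) = cong ((x , f x) ∷_) (zip-map f xs)

indeg-orientBy : (G : Graph) (dir : Vtx G × Vtx G → Bool) (v : Vtx G) →
  indeg G (orientBy G dir) v ≡ count (λ e → headOf (e , dir e) FinP.≟ v) (E G)
indeg-orientBy G dir v = begin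
  indeg G (orientBy G dir) v
    ≡⟨ length-filter≡count head≟v (zip (E G) (toList (orientBy G dir))) ⟩
  count head≟v (zip (E G) (toList (orientBy G dir)))  ≡⟨ cong (count head≟v ∘ zip (E G)) toList-orientBy ⟩
  count head≟v (zip (E G) (map dir (E G)))            ≡⟨ cong (count head≟v) (zip-map dir (E G)) ⟩
  count head≟v (map (λ e → e , dir e) (E G))          ≡⟨ count-map head≟v _ (E G) ⟩
  count (λ e → headOf (e , dir e) FinP.≟ v) (E G)     ∎
  where
  open ≡-Reasoning
  head≟v = λ (p : (Vtx G × Vtx G) × Bool) → headOf p FinP.≟ v
  toList-orientBy : toList (orientBy G dir) ≡ map dir (E G)
  toList-orientBy = trans (toList-map dir (Vec.fromList (E G))) (cong (map dir) (toList∘fromList (E G)))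

Any-allBoolVecs : ∀ {m} {P : Pred (Vec Bool m) p} {O : Vec Bool m} → P O → Any P (allBoolVecs m)
Any-allBoolVecs {O = []ᵥ}        pO = here pO
Any-allBoolVecs {O = true ∷ᵥ O}  pO = ++⁺ˡ (map⁺ {f = true ∷ᵥ_} (Any-allBoolVecs {O = O} pO))
Any-allBoolVecs {m = suc m} {O = false ∷ᵥ O} pO =
  ++⁺ʳ (map (true ∷ᵥ_) (allBoolVecs m)) (++⁺ˡ (map⁺ {f = false ∷ᵥ_} (Any-allBoolVecs {O = O} pO)))

any-compatible⇔ : (G : Graph) (c : Config G) →
  Any (Compatible G c) (allBoolVecs (length (E G))) ⇔ ∃ (Compatible G c)
any-compatible⇔ G c = mk⇔ satisfied (λ (_ , compatible) → Any-allBoolVecs compatible)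

boundedVecs-bounded : ∀ {m} (bs : Vec ℕ m) → All (λ c → ∀ i → lookup c i < lookup bs i) (boundedVecs bs)
boundedVecs-bounded []ᵥ        = (λ ()) ∷ []
boundedVecs-bounded (b ∷ᵥ bs) =
  concat⁺ (All-map⁺ (applyUpTo⁺₁ id b (λ x<b → All-map⁺ (All.map (extend x<b) (boundedVecs-bounded bs)))))
  where
  extend : ∀ {x} {c : Vec ℕ _} → x < b → (∀ i → lookup c i < lookup bs i) →
           ∀ i → lookup (x ∷ᵥ c) i < lookup (b ∷ᵥ bs) i
  extend x<b c<bs zero    = x<b
  extend x<b c<bs (suc i) = c<bs i

v₁ : ∀ {n} → Vtx (K2 n)
v₁ = suc zero

leaf : ∀ {n} → Fin n → Vtx (K2 n)
leaf j = suc (suc j)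

count-E-K2 : ∀ n {P : Pred (Vtx (K2 n) × Vtx (K2 n)) p} (P? : Decidable P) →
  count P? (E (K2 n)) ≡ ∑[ j < n ] ⟦ P? (zero , leaf j) ⟧ + ∑[ j < n ] ⟦ P? (v₁ , leaf j) ⟧
count-E-K2 n P? =
  trans (sum-map-++ (λ e → ⟦ P? e ⟧) (map (λ j → zero , leaf j) (allFin n)) _)
        (cong₂ _+_ (count-map-allFin P? (λ j → zero , leaf j)) (count-map-allFin P? (λ j → v₁ , leaf j)))

length-E-K2 : ∀ n → length (E (K2 n)) ≡ n + n
length-E-K2 n =
  trans (length-++ (map (λ j → zero , leaf j) (allFin n)) {map (λ j → v₁ , leaf j) (allFin n)})
        (cong₂ _+_ (length-map-allFin _) (length-map-allFin _))
  where
  length-map-allFin : (f : Fin n → A) → length (map f (allFin n)) ≡ n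
  length-map-allFin f = trans (length-map f (allFin n)) (length-tabulate id)

deg-K2 : ∀ n (v : Vtx (K2 n)) →
  deg (K2 n) v ≡ ∑[ j < n ] ⟦ (zero FinP.≟ v) ⊎-dec (leaf j FinP.≟ v) ⟧
               + ∑[ j < n ] ⟦ (v₁ FinP.≟ v) ⊎-dec (leaf j FinP.≟ v) ⟧
deg-K2 n v = trans (length-filter≡count incident? (E (K2 n))) (count-E-K2 n incident?)
  where
  incident? = λ (e : Vtx (K2 n) × Vtx (K2 n)) → (proj₁ e FinP.≟ v) ⊎-dec (proj₂ e FinP.≟ v)

deg-v₁ : ∀ n → deg (K2 n) v₁ ≡ n
deg-v₁ n = begin
  deg (K2 n) v₁                ≡⟨ deg-K2 n v₁ ⟩
  ∑[ j < n ] 0 + ∑[ j < n ] 1  ≡⟨ cong₂ _+_ (sum-replicate-zero n) (∑-const n 1) ⟩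
  n * 1                        ≡⟨ *-identityʳ n ⟩
  n                            ∎
  where open ≡-Reasoning

deg-leaf : ∀ n (j : Fin n) → deg (K2 n) (leaf j) ≡ 2
deg-leaf n j = trans (deg-K2 n (leaf j)) (cong₂ _+_ (∑-⟦≟⟧ˡ j) (∑-⟦≟⟧ˡ j))

stableConfigs-K2 : ∀ n → stableConfigs (K2 n) ≡ boundedVecs (n ∷ᵥ Vec.replicate n 2)
stableConfigs-K2 n = cong boundedVecs (cong₂ _∷ᵥ_ (deg-v₁ n) (begin
  Vec.tabulate (deg (K2 n) ∘ leaf)
    ≡⟨ tabulate-cong (λ j → trans (deg-leaf n j) (sym (lookup-replicate j 2))) ⟩
  Vec.tabulate (lookup (Vec.replicate n 2))
    ≡⟨ tabulate∘lookup (Vec.replicate n 2) ⟩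
  Vec.replicate n 2
    ∎))
  where open ≡-Reasoning

Binary : ∀ {n} → Vec ℕ n → Set
Binary {n} cs = ∀ (j : Fin n) → lookup cs j < 2

leafLack : ∀ {n} → Vec ℕ n → ℕ
leafLack {n} cs = ∑[ j < n ] (2 ∸ lookup cs j ∸ 1)

leafChips : ∀ {n} → Vec ℕ n → ℕ
leafChips {n} cs = ∑[ j < n ] lookup cs j

leafDeficit : ∀ {n} → Vec ℕ n → ℕ
leafDeficit {n} cs = ∑[ j < n ] (2 ∸ lookup cs j)

lackLevel-K2 : ∀ n c₁ (cs : Vec ℕ n) → lackLevel (K2 n) (c₁ ∷ᵥ cs) ≡ n ∸ c₁ ∸ 1 + leafLack cs
lackLevel-K2 n c₁ cs =
  trans (sum-map-tabulate (λ i → deg (K2 n) (suc i) ∸ lookup (c₁ ∷ᵥ cs) i ∸ 1) id)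
  (cong₂ _+_ (cong (λ d → d ∸ c₁ ∸ 1) (deg-v₁ n))
             (sum-cong-≗ (λ j → cong (λ d → d ∸ lookup cs j ∸ 1) (deg-leaf n j))))

leafLack+leafChips : ∀ {n} {cs : Vec ℕ n} → Binary cs → leafLack cs + leafChips cs ≡ n
leafLack+leafChips {n} {cs} bin = begin
  leafLack cs + leafChips cs                   ≡⟨ ∑-distrib-+ (λ j → 2 ∸ lookup cs j ∸ 1) (lookup cs) ⟨
  ∑[ j < n ] (2 ∸ lookup cs j ∸ 1 + lookup cs j) ≡⟨ sum-cong-≗ (λ j → lack+chip (bin j)) ⟩
  ∑[ j < n ] 1                                 ≡⟨ ∑-const n 1 ⟩
  n * 1                                        ≡⟨ *-identityʳ n ⟩
  n                                            ∎
  where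
  open ≡-Reasoning
  lack+chip : ∀ {c} → c < 2 → 2 ∸ c ∸ 1 + c ≡ 1
  lack+chip {0} _ = refl
  lack+chip {1} _ = refl
  lack+chip {suc (suc _)} (s≤s (s≤s ()))

leafDeficit+leafChips : ∀ {n} {cs : Vec ℕ n} → Binary cs → leafDeficit cs + leafChips cs ≡ n + n
leafDeficit+leafChips {n} {cs} bin = begin
  leafDeficit cs + leafChips cs                ≡⟨ ∑-distrib-+ (λ j → 2 ∸ lookup cs j) (lookup cs) ⟨
  ∑[ j < n ] (2 ∸ lookup cs j + lookup cs j)    ≡⟨ sum-cong-≗ (λ j → m∸n+n≡m (<⇒≤ (bin j))) ⟩
  ∑[ j < n ] 2                                 ≡⟨ ∑-const n 2 ⟩
  n * 2                                        ≡⟨ *-comm n 2 ⟩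
  n + (n + 0)                                  ≡⟨ cong (n +_) (+-identityʳ n) ⟩
  n + n                                        ∎
  where open ≡-Reasoning

binaryVecs : (n : ℕ) → List (Vec ℕ n)
binaryVecs n = boundedVecs (Vec.replicate n 2)

binaryVecs-binary : ∀ n → All Binary (binaryVecs n)
binaryVecs-binary n = All.map (λ {cs} cs<2 j → subst (lookup cs j <_) (lookup-replicate j 2) (cs<2 j))
                               (boundedVecs-bounded (Vec.replicate n 2))

compatible⇒deficit≤leafChips : ∀ {n c₁} {cs : Vec ℕ n} {O : Orientation (K2 n)} → Binary cs →
  Compatible (K2 n) (c₁ ∷ᵥ cs) O → n ∸ c₁ ≤ leafChips cs
compatible⇒deficit≤leafChips {n} {c₁} {cs} {O} bin compatible =
  +-cancelʳ-≤ (leafDeficit cs) (n ∸ c₁) (leafChips cs) (begin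
    n ∸ c₁ + leafDeficit cs                                 ≤⟨ +-mono-≤ v₁-deficit (∑-mono-≤ leaf-deficit) ⟩
    indeg (K2 n) O v₁ + ∑[ j < n ] indeg (K2 n) O (leaf j)  ≤⟨ m≤n+m _ (indeg (K2 n) O zero) ⟩
    ∑[ v < suc (suc n) ] indeg (K2 n) O v                   ≡⟨ ∑-indeg (K2 n) O ⟩
    length (E (K2 n))                                       ≡⟨ length-E-K2 n ⟩
    n + n                                                   ≡⟨ leafDeficit+leafChips {cs = cs} bin ⟨
    leafDeficit cs + leafChips cs                           ≡⟨ +-comm (leafDeficit cs) (leafChips cs) ⟩
    leafChips cs + leafDeficit cs                           ∎)
  where
  open ≤-Reasoning
  v₁-deficit : n ∸ c₁ ≤ indeg (K2 n) O v₁
  v₁-deficit = subst (λ d → d ∸ c₁ ≤ indeg (K2 n) O v₁) (deg-v₁ n) (compatible zero)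
  leaf-deficit : ∀ j → 2 ∸ lookup cs j ≤ indeg (K2 n) O (leaf j)
  leaf-deficit j =
    subst (λ d → d ∸ lookup cs j ≤ indeg (K2 n) O (leaf j)) (deg-leaf n j) (compatible (suc j))

intoLeaf : ∀ {n} → Vec ℕ n → Vtx (K2 n) × Vtx (K2 n) → Bool
intoLeaf cs (suc zero , suc (suc j)) = lookup cs j ≡ᵇ 0
intoLeaf cs _                        = true

v₁-edge-head : ∀ {n} → Vec ℕ n → Fin n → Vtx (K2 n)
v₁-edge-head cs j = if lookup cs j ≡ᵇ 0 then leaf j else v₁

towardLeaves : ∀ {n} → Vec ℕ n → Orientation (K2 n)
towardLeaves cs = orientBy (K2 _) (intoLeaf cs)

indeg-towardLeaves : ∀ {n} (cs : Vec ℕ n) (v : Vtx (K2 n)) →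
  indeg (K2 n) (towardLeaves cs) v ≡
    ∑[ j < n ] ⟦ leaf j FinP.≟ v ⟧ + ∑[ j < n ] ⟦ v₁-edge-head cs j FinP.≟ v ⟧
indeg-towardLeaves {n} cs v =
  trans (indeg-orientBy (K2 n) (intoLeaf cs) v) (count-E-K2 n (λ e → headOf (e , intoLeaf cs e) FinP.≟ v))

towardLeaves-compatible : ∀ {n c₁} {cs : Vec ℕ n} → Binary cs → n ∸ c₁ ≤ leafChips cs →
  Compatible (K2 n) (c₁ ∷ᵥ cs) (towardLeaves cs)
towardLeaves-compatible {n} {c₁} {cs} bin deficit≤chips zero = begin
  deg (K2 n) v₁ ∸ c₁                                 ≡⟨ cong (_∸ c₁) (deg-v₁ n) ⟩
  n ∸ c₁                                             ≤⟨ deficit≤chips ⟩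
  leafChips cs                                       ≡⟨ sum-cong-≗ (λ j → chip-points-to-v₁ j (bin j)) ⟨
  S                                                  ≡⟨ cong (_+ S) (sum-replicate-zero n) ⟨
  ∑[ j < n ] ⟦ leaf j FinP.≟ v₁ ⟧ + S                ≡⟨ indeg-towardLeaves cs v₁ ⟨
  indeg (K2 n) (towardLeaves cs) v₁                  ∎
  where
  open ≤-Reasoning
  S = ∑[ j < n ] ⟦ v₁-edge-head cs j FinP.≟ v₁ ⟧
  chip-points-to-v₁ : ∀ j {c} → c < 2 → ⟦ (if c ≡ᵇ 0 then leaf j else v₁) FinP.≟ v₁ ⟧ ≡ c
  chip-points-to-v₁ j {0}           _ = refl
  chip-points-to-v₁ j {1}           _ = refl
  chip-points-to-v₁ j {suc (suc _)} (s≤s (s≤s ()))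
towardLeaves-compatible {n} {c₁} {cs} bin _ (suc j) = begin
  deg (K2 n) (leaf j) ∸ lookup cs j                  ≡⟨ cong (_∸ lookup cs j) (deg-leaf n j) ⟩
  2 ∸ lookup cs j                                    ≤⟨ deficit≤ (lookup cs j) refl ⟩
  1 + S                                              ≡⟨ cong (_+ S) (∑-⟦≟⟧ˡ j) ⟨
  ∑[ i < n ] ⟦ leaf i FinP.≟ leaf j ⟧ + S            ≡⟨ indeg-towardLeaves cs (leaf j) ⟨
  indeg (K2 n) (towardLeaves cs) (leaf j)            ∎
  where
  open ≤-Reasoning
  into-j : Fin n → ℕ
  into-j i = ⟦ v₁-edge-head cs i FinP.≟ leaf j ⟧
  S = ∑[ i < n ] into-j i
  empty-leaf-receives : lookup cs j ≡ 0 → into-j j ≡ 1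
  empty-leaf-receives cⱼ≡0 =
    trans (cong (λ c → ⟦ (if c ≡ᵇ 0 then leaf j else v₁) FinP.≟ leaf j ⟧) cⱼ≡0)
          (cong (λ b → if b then 1 else 0) (dec-true (j FinP.≟ j) refl))
  deficit≤ : ∀ c → lookup cs j ≡ c → 2 ∸ c ≤ 1 + S
  deficit≤ zero    cⱼ≡0 = s≤s (subst (_≤ S) (empty-leaf-receives cⱼ≡0) (≤-∑ into-j j))
  deficit≤ (suc c) _    = ≤-trans (m∸n≤m 1 c) (m≤m+n 1 S)

compatible⇔deficit≤leafChips : ∀ {n c₁} {cs : Vec ℕ n} → Binary cs →
  ∃ (Compatible (K2 n) (c₁ ∷ᵥ cs)) ⇔ n ∸ c₁ ≤ leafChips cs
compatible⇔deficit≤leafChips {cs = cs} bin =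
  mk⇔ (λ (_ , compatible) → compatible⇒deficit≤leafChips bin compatible)
      (λ deficit≤chips → towardLeaves cs , towardLeaves-compatible bin deficit≤chips)

-- t stands for the deficit d(v₁) ∸ c(v₁) at v₁, and z, o for leafLack and leafChips of the leaves.
StoAtLevel : (k z o t : ℕ) → Set
StoAtLevel k z o t = t ≤ o × t ∸ 1 + z ≡ k

stoAtLevel? : ∀ k z o → Decidable (StoAtLevel k z o)
stoAtLevel? k z o t = (t ≤? o) ×-dec (t ∸ 1 + z ≟ k)

count-StoAtLevel-< : ∀ {k z o n} → z + o ≡ n → k < n →
  count (λ c₁ → stoAtLevel? k z o (n ∸ c₁)) (upTo n) ≡ ⟦ z ≤? k ⟧
count-StoAtLevel-< {k} {z} {o} {n} z+o≡n k<n =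
  trans (sum-map-upTo-reflect (λ t → ⟦ stoAtLevel? k z o t ⟧) n) (solutions (z ≤? k))
  where
  solutions : (z≤?k : Dec (z ≤ k)) → count (λ t → stoAtLevel? k z o (suc t)) (upTo n) ≡ ⟦ z≤?k ⟧
  solutions (yes z≤k) = count-upTo-unique (λ t → stoAtLevel? k z o (suc t)) (≤-<-trans (m∸n≤m k z) k<n)
    (λ {t} _ → mk⇔ (λ (_ , t+z≡k) → trans (sym (m+n∸n≡m t z)) (cong (_∸ z) t+z≡k))
                   (λ { refl → k∸z<o , m∸n+n≡m z≤k }))
    where
    k∸z<o : k ∸ z < o
    k∸z<o = +-cancelʳ-≤ z (suc (k ∸ z)) o
      (subst₂ _≤_ (cong suc (sym (m∸n+n≡m z≤k))) (trans (sym z+o≡n) (+-comm z o)) k<n)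
  solutions (no z≰k) =
    count-none (λ t → stoAtLevel? k z o (suc t)) (All.universal no-solution (upTo n))
    where
    no-solution : ∀ t → ¬ StoAtLevel k z o (suc t)
    no-solution t (_ , t+z≡k) = z≰k (subst (z ≤_) t+z≡k (m≤n+m z t))

count-StoAtLevel-≥ : ∀ {k z o n} → z + o ≡ n → n ≤ k →
  count (λ c₁ → stoAtLevel? k z o (n ∸ c₁)) (upTo n) ≡ 0
count-StoAtLevel-≥ {k} {z} {o} {n} z+o≡n n≤k =
  trans (sum-map-upTo-reflect (λ t → ⟦ stoAtLevel? k z o t ⟧) n)
        (count-none (λ t → stoAtLevel? k z o (suc t)) (All.universal no-solution (upTo n)))
  where
  open ≤-Reasoning
  no-solution : ∀ t → ¬ StoAtLevel k z o (suc t)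
  no-solution t (t<o , t+z≡k) = <-irrefl refl (begin-strict
    k      ≡⟨ t+z≡k ⟨
    t + z  <⟨ +-monoˡ-< z t<o ⟩
    o + z  ≡⟨ +-comm o z ⟩
    z + o  ≡⟨ z+o≡n ⟩
    n      ≤⟨ n≤k ⟩
    k      ∎)

v₁-choices : (n k : ℕ) → Vec ℕ n → ℕ
v₁-choices n k cs = count (λ c₁ → stoAtLevel? k (leafLack cs) (leafChips cs) (n ∸ c₁)) (upTo n)

count-binaryVecs-suc : ∀ n {P : Pred (Vec ℕ (suc n)) p} (P? : Decidable P) →
  count P? (binaryVecs (suc n)) ≡ count (P? ∘ (0 ∷ᵥ_)) (binaryVecs n) + count (P? ∘ (1 ∷ᵥ_)) (binaryVecs n)
count-binaryVecs-suc n P? = begin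
  count P? (binaryVecs (suc n))
    ≡⟨ sum-map-concatMap (λ c → ⟦ P? c ⟧) (λ x → map (x ∷ᵥ_) (binaryVecs n)) (upTo 2) ⟩
  count P? (map (0 ∷ᵥ_) (binaryVecs n)) + (count P? (map (1 ∷ᵥ_) (binaryVecs n)) + 0)
    ≡⟨ cong₂ _+_ (count-map P? (0 ∷ᵥ_) (binaryVecs n))
                 (trans (+-identityʳ _) (count-map P? (1 ∷ᵥ_) (binaryVecs n))) ⟩
  count (P? ∘ (0 ∷ᵥ_)) (binaryVecs n) + count (P? ∘ (1 ∷ᵥ_)) (binaryVecs n)
    ∎
  where open ≡-Reasoning

binomialSum : ℕ → ℕ → ℕ
binomialSum n k = sum (map (n C_) (upTo (suc k)))

binomialSum-pascal : ∀ n k → binomialSum n k + binomialSum n (suc k) ≡ binomialSum (suc n) (suc k)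
binomialSum-pascal n k = begin
  S + binomialSum n (suc k)                                 ≡⟨ cong (S +_) (sum-map-upTo-suc (n C_) (suc k)) ⟩
  S + suc T                                                 ≡⟨ +-suc S T ⟩
  suc (S + T)                                               ≡⟨ cong suc (sum-map-+ (n C_) (λ i → n C suc i) ks) ⟨
  suc (sum (map (λ i → n C i + n C suc i) ks))              ≡⟨ cong (suc ∘ sum) (map-cong (nCk+nC[k+1]≡[n+1]C[k+1] n) ks) ⟩
  suc (sum (map (λ i → suc n C suc i) ks))                  ≡⟨ sum-map-upTo-suc (suc n C_) (suc k) ⟨
  binomialSum (suc n) (suc k)                               ∎
  where
  open ≡-Reasoning
  ks = upTo (suc k)
  S = binomialSum n k
  T = sum (map (λ i → n C suc i) ks)

count-leafLack-≤ : ∀ n k → count (λ cs → leafLack cs ≤? k) (binaryVecs n) ≡ binomialSum n k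
count-leafLack-≤ zero    k       = sym (trans (sum-map-upTo-suc (0 C_) k) (cong suc (sum-map-zero (upTo k))))
count-leafLack-≤ (suc n) zero    = trans (count-binaryVecs-suc n (λ cs → leafLack cs ≤? 0))
                                         (cong₂ _+_ (sum-map-zero (binaryVecs n)) (count-leafLack-≤ n 0))
count-leafLack-≤ (suc n) (suc k) = begin
  count (λ cs → leafLack cs ≤? suc k) (binaryVecs (suc n))
    ≡⟨ count-binaryVecs-suc n (λ cs → leafLack cs ≤? suc k) ⟩
  count (λ cs → suc (leafLack cs) ≤? suc k) Bs + count (λ cs → leafLack cs ≤? suc k) Bs
    ≡⟨ cong (_+ count (λ cs → leafLack cs ≤? suc k) Bs)
            (count-cong (λ cs → suc (leafLack cs) ≤? suc k) (λ cs → leafLack cs ≤? k) (mk⇔ s≤s⁻¹ s≤s) Bs) ⟩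
  count (λ cs → leafLack cs ≤? k) Bs + count (λ cs → leafLack cs ≤? suc k) Bs
    ≡⟨ cong₂ _+_ (count-leafLack-≤ n k) (count-leafLack-≤ n (suc k)) ⟩
  binomialSum n k + binomialSum n (suc k)
    ≡⟨ binomialSum-pascal n k ⟩
  binomialSum (suc n) (suc k)
    ∎
  where
  open ≡-Reasoning
  Bs = binaryVecs n

stoAtLevel-K2 : ∀ {n k c₁} {cs : Vec ℕ n} → Binary cs →
  (∃ (Compatible (K2 n) (c₁ ∷ᵥ cs)) × lackLevel (K2 n) (c₁ ∷ᵥ cs) ≡ k)
    ⇔ StoAtLevel k (leafLack cs) (leafChips cs) (n ∸ c₁)
stoAtLevel-K2 {n} {k} {c₁} {cs} bin =
  compatible⇔deficit≤leafChips bin ×-⇔ mk⇔ (trans (sym (lackLevel-K2 n c₁ cs))) (trans (lackLevel-K2 n c₁ cs))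

lackCoeff-K2 : ∀ n k → lackCoeff (K2 n) k ≡ sum (map (v₁-choices n k) (binaryVecs n))
lackCoeff-K2 n k = begin
  lackCoeff (K2 n) k                                   ≡⟨ length-filter≡count atLevel? (stoList (K2 n)) ⟩
  count atLevel? (filter sto? (stableConfigs (K2 n)))  ≡⟨ count-filter atLevel? sto? (stableConfigs (K2 n)) ⟩
  count (sto? ∩? atLevel?) (stableConfigs (K2 n))      ≡⟨ cong (count (sto? ∩? atLevel?)) (stableConfigs-K2 n) ⟩
  count (sto? ∩? atLevel?) (boundedVecs bounds)
    ≡⟨ count-cong-local (sto? ∩? atLevel?) Q? (All.map (λ {c} → characterisation {c}) (boundedVecs-bounded bounds)) ⟩
  count Q? (boundedVecs bounds)                        ≡⟨ count-concatMap-map Q? _∷ᵥ_ (upTo n) (binaryVecs n) ⟩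
  sum (map (v₁-choices n k) (binaryVecs n))            ∎
  where
  open ≡-Reasoning
  bounds = n ∷ᵥ Vec.replicate n 2
  sto? = λ (c : Config (K2 n)) → any? (compatible? (K2 n) c) (allBoolVecs (length (E (K2 n))))
  atLevel? = λ (c : Config (K2 n)) → lackLevel (K2 n) c ≟ k
  Q? : Decidable (λ (c : Config (K2 n)) → StoAtLevel k (leafLack (Vec.tail c)) (leafChips (Vec.tail c)) (n ∸ Vec.head c))
  Q? c = stoAtLevel? k (leafLack (Vec.tail c)) (leafChips (Vec.tail c)) (n ∸ Vec.head c)
  characterisation : ∀ {c} → (∀ i → lookup c i < lookup bounds i) →
    (Any (Compatible (K2 n) c) (allBoolVecs (length (E (K2 n)))) × lackLevel (K2 n) c ≡ k)
      ⇔ StoAtLevel k (leafLack (Vec.tail c)) (leafChips (Vec.tail c)) (n ∸ Vec.head c)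
  characterisation {c₁ ∷ᵥ cs} bounded =
    ⇔-trans (any-compatible⇔ (K2 n) (c₁ ∷ᵥ cs) ×-⇔ ⇔-refl) (stoAtLevel-K2 binary)
    where
    binary : Binary cs
    binary j = subst (lookup cs j <_) (lookup-replicate j 2) (bounded (suc j))

theorem6 : (n : ℕ) → 1 ≤ n →
    ((k : ℕ) → k < n → lackCoeff (K2 n) k ≡ sum (map (λ i → n C i) (upTo (suc k))))
    × ((k : ℕ) → n ≤ k → lackCoeff (K2 n) k ≡ 0)
theorem6 n _ = coefficient-< , coefficient-≥
  where
  open ≡-Reasoning
  coefficient-< : (k : ℕ) → k < n → lackCoeff (K2 n) k ≡ binomialSum n k
  coefficient-< k k<n = begin
    lackCoeff (K2 n) k                              ≡⟨ lackCoeff-K2 n k ⟩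
    sum (map (v₁-choices n k) (binaryVecs n))
      ≡⟨ cong sum (map-cong-local (All.map (λ {cs} bin → count-StoAtLevel-< (leafLack+leafChips {cs = cs} bin) k<n)
                                           (binaryVecs-binary n))) ⟩
    count (λ cs → leafLack cs ≤? k) (binaryVecs n)  ≡⟨ count-leafLack-≤ n k ⟩
    binomialSum n k                                 ∎
  coefficient-≥ : (k : ℕ) → n ≤ k → lackCoeff (K2 n) k ≡ 0
  coefficient-≥ k n≤k = begin
    lackCoeff (K2 n) k                              ≡⟨ lackCoeff-K2 n k ⟩
    sum (map (v₁-choices n k) (binaryVecs n))
      ≡⟨ cong sum (map-cong-local (All.map (λ {cs} bin → count-StoAtLevel-≥ (leafLack+leafChips {cs = cs} bin) n≤k)
                                           (binaryVecs-binary n))) ⟩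
    sum (map (λ _ → 0) (binaryVecs n))              ≡⟨ sum-map-zero (binaryVecs n) ⟩
    0                                               ∎
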